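{- In an upward directed GPEA $P$, a normal Riesz $\gamma$-ideal $I$ in $P$ is also a normal Riesz ideal in the $\gamma$-unitization $U$ of $P$.
   Context: $P$ is a GPEA (partial $\oplus$, constant $0$; partial associativity; conjugation; two-sided cancellation; neutral $0$; positivity), ordered by $a\le b$ iff $a\oplus c=b$ for some $c$; for $a\le b$, $a/b$ is the unique $c$ with $a\oplus c=b$ and $b\backslash a$ the unique $d$ with $d\oplus a=b$. Upward directed: any two elements have a common upper bound. $\gamma$ is a unitizing GPEA-automorphism ($\gamma a\oplus b$ defined iff $b\oplus a$ defined). The $\gamma$-unitization $U=P\cup P^\eta$ ($\eta$ a bijection onto a disjoint set, $1:=\eta0$): sums in $P$ as in $P$; $a+\eta b$ defined iff $a\le b$, equal to $\eta(b\backslash a)$; $\eta a+b$ defined iff $\gamma b\le a$, equal to $\eta(\gamma b/a)$; no sums within $P^\eta$; $U$ is a pseudo effect algebra. Ideal: nonempty down-set closed under existing sums; normal: $a\oplus c=c\oplus b$ implies ($a\in I\Leftrightarrow b\in I$); $\gamma$-ideal: $a\in I\Leftrightarrow\gamma a\in I$. Riesz ideal: (R1) if $i\in I$, $i\le a\oplus b$ then $i\le j\oplus k$ for some $j,k\in I$, $j\le a$, $k\le b$; (R2) if $i\in I$, $i\le a$: (i) if $(a\backslash i)\oplus b$ exists there is $j\in I$, $j\le b$, with $a\oplus(j/b)$ existing; (ii) if $b\oplus(i/a)$ exists there is $k\in I$, $k\le b$, with $(b\backslash k)\oplus a$ existing. -}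

module Defs where

open import Data.Product using (Σ; ∃; ∃-syntax; _×_; _,_)
open import Data.Sum using (_⊎_; inj₁; inj₂)
open import Data.Empty using (⊥)
open import Relation.Binary.PropositionalEquality using (_≡_)
open import Function.Bundles using (_⇔_)
open import Function.Definitions using (Bijective)

-- A partial binary operation is represented as a ternary relation:
-- S a b c  means  "a ⊕ b is defined and equals c".
Op : Set → Set₁
Op C = C → C → C → Set

module PartialAlgebra {C : Set} (S : Op C) where

  Defined : C → C → Set
  Defined a b = ∃[ c ] S a b c

  _≤_ : C → C → Set
  a ≤ b = ∃[ c ] S a c b

  record IsIdeal (I : C → Set) : Set where
    field
      nonempty : ∃[ x ] I x
      downset  : ∀ {a b} → a ≤ b → I b → I a
      sumClosed : ∀ {a b c} → S a b c → I a → I b → I c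

  IsNormal : (C → Set) → Set
  IsNormal I = ∀ {a b c d} → S a c d → S c b d → (I a ⇔ I b)

  R1 : (C → Set) → Set
  R1 I = ∀ {i a b s} → I i → S a b s → i ≤ s →
         ∃[ j ] ∃[ k ] ∃[ t ] (I j × I k × j ≤ a × k ≤ b × S j k t × i ≤ t)

  -- (R2)(i): i ∈ I, i ≤ a, (a \ i) ⊕ b exists  ⇒
  --   ∃ j ∈ I, j ≤ b, with a ⊕ (j / b) existing.
  -- Here  a \ i  is the d with d ⊕ i = a, and  j / b  is the e with j ⊕ e = b.
  R2i : (C → Set) → Set
  R2i I = ∀ {i a b d} → I i → i ≤ a → S d i a → Defined d b →
          ∃[ j ] ∃[ e ] (I j × S j e b × Defined a e)

  -- (R2)(ii): i ∈ I, i ≤ a, b ⊕ (i / a) exists  ⇒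
  --   ∃ k ∈ I, k ≤ b, with (b \ k) ⊕ a existing.
  -- Here  i / a  is the c with i ⊕ c = a, and  b \ k  is the d with d ⊕ k = b.
  R2ii : (C → Set) → Set
  R2ii I = ∀ {i a b c} → I i → i ≤ a → S i c a → Defined b c →
           ∃[ k ] ∃[ d ] (I k × S d k b × Defined d a)

  record IsRieszIdeal (I : C → Set) : Set where
    field
      ideal : IsIdeal I
      r1    : R1 I
      r2i   : R2i I
      r2ii  : R2ii I

  IsNormalRieszIdeal : (C → Set) → Set
  IsNormalRieszIdeal I = IsRieszIdeal I × IsNormal I

record GPEA : Set₁ where
  field
    Carrier : Set
    S       : Op Carrier
    𝟘       : Carrier
    functional : ∀ {a b c c'} → S a b c → S a b c' → c ≡ c'
    assocʳ : ∀ {a b c d e} → S a b d → S d c e → ∃[ f ] (S b c f × S a f e)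
    assocˡ : ∀ {a b c f e} → S b c f → S a f e → ∃[ d ] (S a b d × S d c e)
    conjugation : ∀ {a b c} → S a b c → (∃[ d ] S d a c) × (∃[ e ] S b e c)
    cancelˡ : ∀ {a b b' c} → S a b c → S a b' c → b ≡ b'
    cancelʳ : ∀ {a b b' c} → S b a c → S b' a c → b ≡ b'
    neutralʳ : ∀ a → S a 𝟘 a
    neutralˡ : ∀ a → S 𝟘 a a
    positivity : ∀ {a b} → S a b 𝟘 → (a ≡ 𝟘) × (b ≡ 𝟘)

module GPEANotions (P : GPEA) where
  open GPEA P public
  open PartialAlgebra S public

  UpwardDirected : Set
  UpwardDirected = ∀ a b → ∃[ c ] (a ≤ c × b ≤ c)

  record IsAutomorphism (γ : Carrier → Carrier) : Set where
    field
      bijective : Bijective _≡_ _≡_ γ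
      preserves : ∀ {a b c} → S a b c → S (γ a) (γ b) (γ c)
      reflects  : ∀ {a b c} → S (γ a) (γ b) (γ c) → S a b c

  IsUnitizing : (Carrier → Carrier) → Set
  IsUnitizing γ = ∀ a b → (Defined (γ a) b ⇔ Defined b a)

  record IsUnitizingAutomorphism (γ : Carrier → Carrier) : Set where
    field
      automorphism : IsAutomorphism γ
      unitizing    : IsUnitizing γ

  IsγIdeal : (Carrier → Carrier) → (Carrier → Set) → Set
  IsγIdeal γ I = IsIdeal I × (∀ a → I a ⇔ I (γ a))

  -- The γ-unitization U = P ∪ P^η, with inj₁ a = a and inj₂ a = η a.

  U : Set
  U = Carrier ⊎ Carrier

  η : Carrier → U
  η = inj₂

  data US (γ : Carrier → Carrier) : Op U where
    inP  : ∀ {a b c} → S a b c → US γ (inj₁ a) (inj₁ b) (inj₁ c)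
    -- a + η b defined iff a ≤ b, and equals η (b \ a), where (b \ a) ⊕ a = b
    inPη : ∀ {a b d} → S d a b → US γ (inj₁ a) (η b) (η d)
    -- η a + b defined iff γ b ≤ a, and equals η (γ b / a), where γ b ⊕ c = a
    inηP : ∀ {a b c} → S (γ b) c a → US γ (η a) (inj₁ b) (η c)
    -- no sums within P^η

  embed : (Carrier → Set) → U → Set
  embed I (inj₁ a) = I a
  embed I (inj₂ _) = ⊥

-- Every element of I lies in P, so each axiom for U splits into finitely
-- many cases according to which of the three kinds of sums in U
-- (inside P, a + η b, η a + b) occur.  The case inside P is the
-- corresponding axiom for I in P; every mixed case is translated into a
-- statement purely about P and proved there.

module Submission where

open import Defs
open import Data.Product using (_×_; ∃-syntax; _,_; proj₁; proj₂)
open import Data.Sum using (inj₁; inj₂)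
open import Relation.Binary.PropositionalEquality using (_≡_; refl)
open import Function.Bundles using (_⇔_; mk⇔; Equivalence)

module GPEAOrder (P : GPEA) where
  open GPEANotions P

  ≤-trans : ∀ {a b c} → a ≤ b → b ≤ c → a ≤ c
  ≤-trans (_ , s₁) (_ , s₂) with assocʳ s₁ s₂
  ... | _ , _ , s = _ , s

  summandʳ-≤ : ∀ {a b c} → S a b c → b ≤ c
  summandʳ-≤ s = proj₂ (conjugation s)

  ≤⇒leftComplement : ∀ {a b} → a ≤ b → ∃[ d ] S d a b
  ≤⇒leftComplement (_ , s) = proj₁ (conjugation s)

  ⊕-monoʳ : ∀ {a w z r} → w ≤ z → S a z r → ∃[ q ] (S a w q × q ≤ r)
  ⊕-monoʳ (v , wv) az with assocˡ wv az
  ... | q , aw , qv = q , aw , (v , qv)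

  ⊕-monoˡ : ∀ {a w z r} → w ≤ z → S z a r → ∃[ q ] (S w a q × q ≤ r)
  ⊕-monoˡ w≤z za with ≤⇒leftComplement w≤z
  ... | _ , vw with assocʳ vw za
  ... | q , wa , vq = q , wa , summandʳ-≤ vq

  commonExtension : UpwardDirected → ∀ {s x y u v} → S s x u → S s y v →
                    ∃[ p ] ∃[ q ] ∃[ c ] (S x p c × S y q c × Defined s c)
  commonExtension up {u = u} {v} sx sy with up u v
  ... | T , (p , uT) , (q , vT) with assocʳ sx uT | assocʳ sy vT
  ... | c , xp , sc | _ , yq , sc' with cancelˡ sc sc'
  ... | refl = p , q , c , xp , yq , (T , sc)

  -- For a unitizing γ: if s ⊕ (q ⊕ b) exists then so does (γ b ⊕ s) ⊕ q.
  -- This is what makes η(γ b ⊕ s) + q defined in the unitization.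
  unitizingShift : ∀ {γ} → IsUnitizing γ → ∀ {b s a q c} →
                   S (γ b) s a → S q b c → Defined s c → Defined a q
  unitizingShift unitizing {b} bsa qb (_ , sc) with assocˡ qb sc
  ... | e , sq , eb with Equivalence.from (unitizing b e) (_ , eb)
  ... | _ , be with assocˡ sq be
  ... | _ , bs , aq with functional bs bsa
  ... | refl = _ , aq

module NormalShift (P : GPEA) {I : GPEA.Carrier P → Set}
                   (normal : PartialAlgebra.IsNormal (GPEA.S P) I) where
  open GPEANotions P

  shiftRight : ∀ {a c d} → I a → S a c d → ∃[ b ] (I b × S c b d)
  shiftRight ia ac with proj₂ (conjugation ac)
  ... | _ , cb = _ , Equivalence.to (normal ac cb) ia , cb

  shiftLeft : ∀ {b c d} → I b → S c b d → ∃[ a ] (I a × S a c d)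
  shiftLeft ib cb with proj₁ (conjugation cb)
  ... | _ , ac = _ , Equivalence.from (normal ac cb) ib , ac

module RieszConsequences (P : GPEA) (I : GPEA.Carrier P → Set)
                         (r1 : PartialAlgebra.R1 (GPEA.S P) I) where
  open GPEANotions P
  open GPEAOrder P

  splitLeft : ∀ {i a b c d} → I i → S i a d → S c b d →
              ∃[ k ] ∃[ m ] (I k × S k m b × m ≤ a)
  splitLeft ii ia cb with r1 ii cb (_ , ia)
  ... | _ , k , _ , _ , ik , j≤c , (m , km) , jk , i≤t with assocˡ km cb
  ... | _ , ck , zm with ⊕-monoˡ j≤c ck
  ... | _ , jk' , t≤z with functional jk' jk
  ... | refl with ≤-trans i≤t t≤z
  ... | _ , iw with assocʳ iw zm
  ... | _ , wm , ih with cancelˡ ih ia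
  ... | refl = k , m , ik , km , summandʳ-≤ wm

  splitRight : ∀ {i a b c d} → I i → S a i d → S b c d →
               ∃[ k ] ∃[ m ] (I k × S m k b × ∃[ y ] S y m a)
  splitRight ii ai bc with r1 ii bc (summandʳ-≤ ai)
  ... | j , _ , _ , ij , _ , j≤b , k≤c , jk , i≤t with ≤⇒leftComplement j≤b
  ... | m , mj with assocʳ mj bc
  ... | _ , jc , mf with ⊕-monoʳ k≤c jc
  ... | _ , jk' , t≤f with functional jk' jk
  ... | refl with ≤⇒leftComplement (≤-trans i≤t t≤f)
  ... | w , wi with assocˡ wi mf
  ... | _ , mw , hi with cancelʳ hi ai
  ... | refl = j , m , ij , mj , ≤⇒leftComplement (w , mw)

  module Directed (up : UpwardDirected) where

    rieszCover : ∀ {i s a b} → I i → Defined s i → S s a b →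
                 ∃[ j ] ∃[ k ] ∃[ t ]
                   (I j × I k × j ≤ a × Defined b k × S j k t × i ≤ t)
    rieszCover ii (_ , si) sa with commonExtension up si sa
    ... | p , _ , _ , ip , aq , (_ , sc) with assocˡ aq sc
    ... | _ , sa' , bq with functional sa' sa
    ... | refl with r1 ii aq (p , ip)
    ... | j , k , t , ij , ik , j≤a , k≤q , jk , i≤t with ⊕-monoʳ k≤q bq
    ... | e , bk , _ = j , k , t , ij , ik , j≤a , (e , bk) , jk , i≤t

    rieszExtend : ∀ {i s a r b} → I i → S s i a → S s r b →
                  ∃[ k ] ∃[ e ] (I k × S b k e × a ≤ e)
    rieszExtend ii si sr with rieszCover ii (_ , si) sr
    ... | _ , k , _ , _ , ik , j≤r , (e , bk) , jk , i≤t with assocʳ sr bk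
    ... | _ , rk , sg with ⊕-monoˡ j≤r rk
    ... | _ , jk' , t≤g with functional jk' jk
    ... | refl with ⊕-monoʳ (≤-trans i≤t t≤g) sg
    ... | _ , si' , a≤e with functional si' si
    ... | refl = k , e , ik , bk , a≤e

    rieszCoverUnitizing : ∀ {γ} → IsUnitizing γ → ∀ {i s a b} →
                          I i → Defined s i → S (γ b) s a →
                          ∃[ j ] ∃[ k ] ∃[ t ]
                            (I j × I k × Defined a j × k ≤ b × S j k t × i ≤ t)
    rieszCoverUnitizing unitizing {s = s} {b = b} ii (_ , si) bsa
      with Equivalence.to (unitizing b s) (_ , bsa)
    ... | _ , sb with commonExtension up si sb
    ... | p , q , _ , ip , bq , sc with ≤⇒leftComplement (q , bq)
    ... | _ , qb with r1 ii qb (p , ip)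
    ... | j , k , t , ij , ik , j≤q , k≤b , jk , i≤t
      with unitizingShift unitizing bsa qb sc
    ... | _ , aq with ⊕-monoʳ j≤q aq
    ... | _ , aj , _ = j , k , t , ij , ik , (_ , aj) , k≤b , jk , i≤t

module Unitization (P : GPEA) where
  open GPEANotions P
  open GPEAOrder P

  module _ (up : UpwardDirected)
           (γ : Carrier → Carrier) (γaut : IsUnitizingAutomorphism γ)
           (I : Carrier → Set) (rI : IsRieszIdeal I) (nI : IsNormal I)
           (γI : ∀ a → I a ⇔ I (γ a)) where
    open IsUnitizingAutomorphism γaut
    open IsAutomorphism automorphism
    open IsRieszIdeal rI
    open IsIdeal ideal
    open NormalShift P nI
    open RieszConsequences P I r1
    open Directed up
    module UA = PartialAlgebra (US γ)

    γ-preimage : ∀ y → ∃[ x ] γ x ≡ y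
    γ-preimage y with proj₂ bijective y
    ... | x , γx≡y = x , γx≡y refl

    I-fromγ : ∀ {x} → I (γ x) → I x
    I-fromγ {x} = Equivalence.from (γI x)

    I-toγ : ∀ {x} → I x → I (γ x)
    I-toγ {x} = Equivalence.to (γI x)

    lift≤ : ∀ {a b} → a ≤ b → UA._≤_ (inj₁ a) (inj₁ b)
    lift≤ (c , ac) = inj₁ c , inP ac

    -- Sums and order in U below an element of P stay in P.
    idealU : UA.IsIdeal (embed I)
    idealU = record
      { nonempty  = inj₁ (proj₁ nonempty) , proj₂ nonempty
      ; downset   = λ { (_ , inP ab) ib → downset (_ , ab) ib }
      ; sumClosed = λ { (inP ab) ia ib → sumClosed ab ia ib }
      }

    -- The only mixed case a + η c = η d = η c + b reads d ⊕ a = c = γ b ⊕ d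
    -- in P; normality relates a and γ b, and γ-invariance γ b and b.
    normalU : UA.IsNormal (embed I)
    normalU (inP ac) (inP cb)   = nI ac cb
    normalU (inPη da) (inηP bd) =
      mk⇔ (λ ia → I-fromγ (Equivalence.from (nI bd da) ia))
          (λ ib → Equivalence.to (nI bd da) (I-toγ ib))
    normalU (inηP _) (inPη _)   = mk⇔ (λ ()) (λ ())

    -- (R1) in U: the mixed cases are rieszCover and rieszCoverUnitizing.
    r1U : UA.R1 (embed I)
    r1U {inj₁ _} ii (inP ab) (_ , inP is) with r1 ii ab (_ , is)
    ... | j , k , t , ij , ik , j≤a , k≤b , jk , i≤t =
      inj₁ j , inj₁ k , inj₁ t , ij , ik , lift≤ j≤a , lift≤ k≤b , inP jk , lift≤ i≤t
    r1U {inj₁ _} ii (inPη sa) (_ , inPη si) with rieszCover ii (_ , si) sa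
    ... | j , k , t , ij , ik , j≤a , (e , bk) , jk , i≤t =
      inj₁ j , inj₁ k , inj₁ t , ij , ik , lift≤ j≤a , (inj₂ e , inPη bk) , inP jk , lift≤ i≤t
    r1U {inj₁ _} ii (inηP bs) (_ , inPη si)
      with rieszCoverUnitizing unitizing ii (_ , si) bs
    ... | j , k , t , ij , ik , (w , aj) , k≤b , jk , i≤t =
      inj₁ j , inj₁ k , inj₁ t , ij , ik , (inj₂ w , inPη aj) , lift≤ k≤b , inP jk , lift≤ i≤t

    -- (R2)(i) in U: for d ∈ P and b = η b' it is rieszExtend; for d = η d'
    -- it is splitLeft applied to γ i.
    r2iU : UA.R2i (embed I)
    r2iU {inj₁ _} ii _ (inP di) (_ , inP db) with r2i ii (summandʳ-≤ di) di (_ , db)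
    ... | j , e , ij , je , (_ , ae) = inj₁ j , inj₁ e , ij , inP je , (inj₁ _ , inP ae)
    r2iU {inj₁ _} ii _ (inP di) (_ , inPη xd) with proj₂ (conjugation xd)
    ... | _ , dr with rieszExtend ii di dr
    ... | k , e , ik , bk , a≤e with ≤⇒leftComplement a≤e
    ... | y , ya = inj₁ k , inj₂ e , ik , inPη bk , (inj₂ y , inPη ya)
    r2iU {inj₁ _} ii _ (inηP ia) (_ , inηP bx) with proj₁ (conjugation bx)
    ... | _ , cb with splitLeft (I-toγ ii) ia cb
    ... | k , m , ik , km , (c , mc) with γ-preimage k | γ-preimage m
    ... | j , refl | e , refl =
      inj₁ j , inj₁ e , I-fromγ ik , inP (reflects km) , (inj₂ c , inηP mc)

    -- (R2)(ii) in U: for a ∈ P and b = η b' it is rieszExtend applied to the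
    -- γ-image, followed by a normal shift; for a = η a' it is splitRight.
    r2iiU : UA.R2ii (embed I)
    r2iiU {inj₁ _} ii _ (inP ic) (_ , inP bc) with r2ii ii (_ , ic) ic (_ , bc)
    ... | k , d , ik , dk , (_ , da) = inj₁ k , inj₁ d , ik , inP dk , (inj₁ _ , inP da)
    r2iiU {inj₁ _} ii _ (inP ic) (_ , inηP cx) with shiftRight (I-toγ ii) (preserves ic)
    ... | _ , iy , cy with rieszExtend iy cy cx
    ... | _ , e , ik , bk , (w , aw) with shiftLeft ik bk
    ... | K , iK , Kb with γ-preimage K
    ... | k , refl = inj₁ k , inj₂ e , I-fromγ iK , inηP Kb , (inj₂ w , inηP aw)
    r2iiU {inj₁ _} ii _ (inPη ai) (_ , inPη xb) with proj₂ (conjugation xb)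
    ... | _ , bx with splitRight ii ai bx
    ... | k , m , ik , mk , (y , ym) = inj₁ k , inj₁ m , ik , inP mk , (inj₂ y , inPη ym)

    isNormalRieszIdeal : UA.IsNormalRieszIdeal (embed I)
    isNormalRieszIdeal =
      record { ideal = idealU ; r1 = r1U ; r2i = r2iU ; r2ii = r2iiU } , normalU

corollary4p21 : (P : GPEA) → let open GPEANotions P in
    UpwardDirected →
    (γ : Carrier → Carrier) → IsUnitizingAutomorphism γ →
    (I : Carrier → Set) →
    IsNormalRieszIdeal I → IsγIdeal γ I →
    PartialAlgebra.IsNormalRieszIdeal (US γ) (embed I)
corollary4p21 P up γ γaut I (rI , nI) (_ , γI) =
  Unitization.isNormalRieszIdeal P up γ γaut I rI nI γI
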